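{- Let $t\in V(G)\setminus\{s\}$ and let $q$ be a vertex from which $t$ is reachable in $H_{i-1}^t$. Then the minimum cost of a path from $q$ to $t$ in $H_{i-1}^t$ is non-negative.
   Context: Let $G$ be a directed graph with vertex set $V(G)$ and edge set $E(G)$, with non-negative edge costs $c$; $G$ is anti-symmetric (if $(u,v)\in E(G)$ then $(v,u)\notin E(G)$). The cost of a path is the sum of its edge costs. Fix a source $s$ and an integer $p\ge1$ such that $G$ is $p$-edge-outconnected from $s$ (for every $t\ne s$ there are $p$ pairwise edge-disjoint $s$–$t$ paths in $G$). Fix $2\le i\le p$ and a spanning subgraph $H_{i-1}$ of $G$. For every $t\neq s$ let $S_{i-1}^t\subseteq E(H_{i-1})$ be the edge set of $i-1$ pairwise edge-disjoint $s$–$t$ paths of minimum total cost among all such families in $G$. The graph $H_{i-1}^t$ (on vertex set $V(G)$) is obtained from $H_{i-1}$ by replacing each edge $(u,v)\in S_{i-1}^t$ by $(v,u)$ with cost $-c(u,v)$ and adding all edges of $E(G)\setminus S_{i-1}^t$ incident to $t$. -}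

module Defs where

open import Data.Nat using (ℕ; zero; suc; _+_)
open import Data.Integer as ℤ using (ℤ; +_; -_)
open import Data.Fin using (Fin; zero; suc)
open import Data.List using (List; []; _∷_)
open import Data.List.Relation.Unary.Unique.Propositional using (Unique)
open import Data.Product using (Σ; ∃; _×_; _,_)
open import Data.Sum using (_⊎_)
open import Data.Empty using (⊥)
open import Relation.Nullary using (¬_)
open import Relation.Binary.PropositionalEquality using (_≡_; _≢_)

Graph : ℕ → Set₁
Graph n = Fin n → Fin n → Set

AntiSymmetric : ∀ {n} → Graph n → Set
AntiSymmetric E = ∀ u v → E u v → ¬ E v u

SpanningSubgraph : ∀ {n} → Graph n → Graph n → Set
SpanningSubgraph H G = ∀ u v → H u v → G u v

data Walk {n} (E : Graph n) : Fin n → Fin n → Set where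
  []  : ∀ {x} → Walk E x x
  _∷_ : ∀ {x y z} → E x y → Walk E y z → Walk E x z

vertices : ∀ {n} {E : Graph n} {x y} → Walk E x y → List (Fin n)
vertices {x = x} []      = x ∷ []
vertices {x = x} (e ∷ w) = x ∷ vertices w

IsPath : ∀ {n} {E : Graph n} {x y} → Walk E x y → Set
IsPath w = Unique (vertices w)

data EdgeIn {n} {E : Graph n} (u v : Fin n) : ∀ {x y} → Walk E x y → Set where
  here  : ∀ {z} {e : E u v} {w : Walk E v z} → EdgeIn u v (e ∷ w)
  there : ∀ {x y z} {e : E x y} {w : Walk E y z} → EdgeIn u v w → EdgeIn u v (e ∷ w)

costℕ : ∀ {n} {E : Graph n} {x y} → (Fin n → Fin n → ℕ) → Walk E x y → ℕ
costℕ c [] = 0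
costℕ {x = x} c (_∷_ {y = y} e w) = c x y + costℕ c w

EdgeDisjoint : ∀ {n} {E : Graph n} {s t} {k} → (Fin k → Walk E s t) → Set
EdgeDisjoint {n} P = ∀ a b → a ≢ b → ∀ (u v : Fin n) → EdgeIn u v (P a) → EdgeIn u v (P b) → ⊥

IsPathFamily : ∀ {n} {E : Graph n} {s t} {k} → (Fin k → Walk E s t) → Set
IsPathFamily P = (∀ a → IsPath (P a)) × EdgeDisjoint P

sumFin : ∀ {k} → (Fin k → ℕ) → ℕ
sumFin {zero}  f = 0
sumFin {suc k} f = f zero + sumFin (λ a → f (suc a))

familyCost : ∀ {n} {E : Graph n} {s t} {k} → (Fin n → Fin n → ℕ) → (Fin k → Walk E s t) → ℕ
familyCost c P = sumFin (λ a → costℕ c (P a))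

OutConnected : ∀ {n} → Graph n → Fin n → ℕ → Set
OutConnected E s p = ∀ t → t ≢ s → Σ (Fin p → Walk E s t) IsPathFamily

EdgeSetOf : ∀ {n} {E : Graph n} {s t} {k} → (Fin k → Walk E s t) → Graph n
EdgeSetOf P u v = ∃ λ a → EdgeIn u v (P a)

data Ht {n} (G H S : Graph n) (t : Fin n) : Graph n where
  keep : ∀ {u v} → H u v → ¬ S u v → Ht G H S t u v
  rev  : ∀ {u v} → S v u → Ht G H S t u v
  add  : ∀ {u v} → G u v → ¬ S u v → (u ≡ t ⊎ v ≡ t) → Ht G H S t u v

htEdgeCost : ∀ {n} {G H S : Graph n} {t} (c : Fin n → Fin n → ℕ) {u v} → Ht G H S t u v → ℤ
htEdgeCost c {u} {v} (keep _ _)  = + c u v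
htEdgeCost c {u} {v} (rev _)     = - (+ c v u)
htEdgeCost c {u} {v} (add _ _ _) = + c u v

htCost : ∀ {n} {G H S : Graph n} {t} (c : Fin n → Fin n → ℕ) {x y} → Walk (Ht G H S t) x y → ℤ
htCost c []      = + 0
htCost c (e ∷ w) = htEdgeCost c e ℤ.+ htCost c w

Reachable : ∀ {n} → Graph n → Fin n → Fin n → Set
Reachable E x y = Walk E x y

{-# OPTIONS --safe #-}
-- The edges L₀ of the minimum-cost family S form a k-unit s–t flow, and H^t embeds into the
-- residual graph of G with respect to L₀ (edges of G outside L₀ at their cost, reversed edges
-- of L₀ at negated cost). The residual graph has no negative cycle: rerouting L₀ around one
-- gives a cheaper set of distinct edges with excess k at s and -k at t, which decomposes into
-- k edge-disjoint s–t paths, contradicting minimality. A walk into t that uses a reversed edge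
-- (u , x) is closed up by the reversed tail from x to t of the path of S through (u , x); that
-- return walk costs at most 0 and the closed walk at least 0, so the walk costs at least 0.
module Submission where

open import Defs
open import Data.Nat as ℕ using (ℕ; zero; suc; _≤_; _∸_)
import Data.Nat.Properties as ℕP
open import Data.Integer as ℤ using (ℤ; +_; -_; _+_; _-_; _*_; 0ℤ; 1ℤ)
import Data.Integer.Properties as ℤP
open import Data.Integer.Tactic.RingSolver using (solve-∀)
open import Data.Fin as Fin using (Fin; zero; suc)
open import Data.Fin.Properties using (suc-injective)
open import Data.List using (List; []; _∷_; _++_; length)
open import Data.List.Membership.Propositional using (_∈_; _∉_)
open import Data.List.Membership.Propositional.Properties using (∈-++⁺ˡ; ∈-++⁺ʳ; ∈-++⁻)
import Data.List.Membership.DecPropositional as DecMembership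
open import Data.List.Relation.Unary.Any using (here; there)
open import Data.List.Relation.Unary.All as All using (All; []; _∷_)
open import Data.List.Relation.Unary.All.Properties using (¬Any⇒All¬; All¬⇒¬Any)
open import Data.List.Relation.Unary.AllPairs using ([]; _∷_)
open import Data.List.Relation.Unary.Unique.Propositional using (Unique)
import Data.List.Relation.Unary.Unique.Propositional.Properties as Unique
open import Data.Product using (Σ; ∃; _×_; _,_; proj₁; proj₂)
open import Data.Product.Properties using (≡-dec)
open import Data.Sum as Sum using (_⊎_; inj₁; inj₂)
open import Data.Empty using (⊥; ⊥-elim)
open import Function using (_∘_)
open import Relation.Nullary using (yes; no; Dec)
open import Relation.Binary.Definitions using (DecidableEquality)
open import Relation.Binary.PropositionalEquality
  using (_≡_; _≢_; refl; sym; trans; cong; cong₂; subst; module ≡-Reasoning)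

private
  [x+y]-x≡y : ∀ x y → (x + y) - x ≡ y
  [x+y]-x≡y = solve-∀

  [x-y]-z≡x-[z+y] : ∀ x y z → (x - y) - z ≡ x - (z + y)
  [x-y]-z≡x-[z+y] = solve-∀

  x+[y-x]≡y : ∀ x y → x + (y - x) ≡ y
  x+[y-x]≡y = solve-∀

module _ {n : ℕ} {E : Graph n} where

  infixr 5 _++ʷ_

  _++ʷ_ : ∀ {x y z} → Walk E x y → Walk E y z → Walk E x z
  []      ++ʷ q = q
  (e ∷ p) ++ʷ q = e ∷ (p ++ʷ q)

  _⊆ᵉ_ : ∀ {x y x′ y′} → Walk E x y → Walk E x′ y′ → Set
  p ⊆ᵉ w = ∀ {u v} → EdgeIn u v p → EdgeIn u v w

  end∈vertices : ∀ {x y} (w : Walk E x y) → y ∈ vertices w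
  end∈vertices []      = here refl
  end∈vertices (e ∷ w) = there (end∈vertices w)

  EdgeIn⇒edge : ∀ {u v x y} {w : Walk E x y} → EdgeIn u v w → E u v
  EdgeIn⇒edge (here {e = e}) = e
  EdgeIn⇒edge (there h)      = EdgeIn⇒edge h

  suffixFrom : ∀ {u a x y} {w : Walk E x y} → EdgeIn u a w → Σ (Walk E a y) (_⊆ᵉ w)
  suffixFrom (here {w = w}) = w , there
  suffixFrom (there h)      = let B , B⊆w = suffixFrom h in B , there ∘ B⊆w

  tails : ∀ {x y} → Walk E x y → List (Fin n)
  tails []              = []
  tails {x = x} (e ∷ w) = x ∷ tails w

  ∈tails⇒∈vertices : ∀ {x y z} (w : Walk E x y) → z ∈ tails w → z ∈ vertices w
  ∈tails⇒∈vertices (e ∷ w) (here refl) = here refl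
  ∈tails⇒∈vertices (e ∷ w) (there h)   = there (∈tails⇒∈vertices w h)

  path⇒tails-unique : ∀ {x y} (w : Walk E x y) → IsPath w → Unique (tails w)
  path⇒tails-unique []      _            = []
  path⇒tails-unique (e ∷ w) (x∉w ∷ path) =
    All.tabulate (All.lookup x∉w ∘ ∈tails⇒∈vertices w) ∷ path⇒tails-unique w path

  path⇒end∉tails : ∀ {x y} (w : Walk E x y) → IsPath w → y ∉ tails w
  path⇒end∉tails (e ∷ w) (x∉w ∷ _)    (here refl) = All.lookup x∉w (end∈vertices w) refl
  path⇒end∉tails (e ∷ w) (_   ∷ path) (there h)   = path⇒end∉tails w path h

  closedPath≡[] : ∀ {x} (w : Walk E x x) → IsPath w → w ≡ []
  closedPath≡[] []      _         = refl
  closedPath≡[] (e ∷ w) (x∉w ∷ _) = ⊥-elim (All.lookup x∉w (end∈vertices w) refl)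

module WeightedWalks {n : ℕ} {E : Graph n} (κ : ∀ {u v} → E u v → ℤ) where

  open DecMembership (Fin._≟_ {n}) using (_∈?_)

  weight : ∀ {x y} → Walk E x y → ℤ
  weight []      = 0ℤ
  weight (e ∷ w) = κ e + weight w

  weight-++ : ∀ {x y z} (p : Walk E x y) (q : Walk E y z) → weight (p ++ʷ q) ≡ weight p + weight q
  weight-++ []      q = sym (ℤP.+-identityˡ (weight q))
  weight-++ (e ∷ p) q =
    trans (cong (_+_ (κ e)) (weight-++ p q)) (sym (ℤP.+-assoc (κ e) (weight p) (weight q)))

  weight-nonneg : (∀ {u v} (e : E u v) → 0ℤ ℤ.≤ κ e) →
                  ∀ {x y} (w : Walk E x y) → 0ℤ ℤ.≤ weight w
  weight-nonneg κ≥0 []      = ℤP.≤-refl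
  weight-nonneg κ≥0 (e ∷ w) = ℤP.+-mono-≤ (κ≥0 e) (weight-nonneg κ≥0 w)

  record Split {u y} (p : Walk E u y) (x : Fin n) : Set where
    field
      prefix          : Walk E u x
      suffix          : Walk E x y
      prefix-path     : IsPath prefix
      suffix-path     : IsPath suffix
      prefix-vertices : ∀ {z} → z ∈ vertices prefix → z ∈ vertices p
      suffix⊆         : suffix ⊆ᵉ p
      weight-split    : weight prefix + weight suffix ≡ weight p

  splitAt : ∀ {u y} (p : Walk E u y) → IsPath p → ∀ {x} → x ∈ vertices p → Split p x
  splitAt [] path (here refl) = record
    { prefix = [] ; suffix = [] ; prefix-path = path ; suffix-path = path
    ; prefix-vertices = λ h → h ; suffix⊆ = λ h → h ; weight-split = refl }
  splitAt {u} (e ∷ p) path {x} x∈ with x Fin.≟ u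
  ... | yes refl = record
    { prefix = [] ; suffix = e ∷ p ; prefix-path = [] ∷ [] ; suffix-path = path
    ; prefix-vertices = λ { (here refl) → here refl }
    ; suffix⊆ = λ h → h ; weight-split = ℤP.+-identityˡ _ }
  splitAt (e ∷ p) path         (here x≡u)  | no x≢u = ⊥-elim (x≢u x≡u)
  splitAt (e ∷ p) (u∉p ∷ path) (there x∈p) | no _ = record
    { prefix          = e ∷ prefix
    ; suffix          = suffix
    ; prefix-path     = All.tabulate (All.lookup u∉p ∘ prefix-vertices) ∷ prefix-path
    ; suffix-path     = suffix-path
    ; prefix-vertices = λ { (here eq) → here eq ; (there h) → there (prefix-vertices h) }
    ; suffix⊆         = there ∘ suffix⊆
    ; weight-split    = trans (ℤP.+-assoc (κ e) _ _) (cong (_+_ (κ e)) weight-split) }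
    where open Split (splitAt p path x∈p)

  record NegativeCycle : Set where
    field
      {v₀ v₁}      : Fin n
      edge         : E v₀ v₁
      back         : Walk E v₁ v₀
      back-path    : IsPath back
      negative     : weight (edge ∷ back) ℤ.< 0ℤ

  ShorterPath : ∀ {x y} → Walk E x y → Set
  ShorterPath {x} {y} w = Σ (Walk E x y) λ p → IsPath p × weight p ℤ.≤ weight w × p ⊆ᵉ w

  -- Shortcut the first repeated vertex: the cut-off closed walk is a simple cycle, and
  -- if it is not negative, dropping it does not increase the weight.
  negativeCycle⊎shorterPath : ∀ {x y} (w : Walk E x y) → NegativeCycle ⊎ ShorterPath w
  negativeCycle⊎shorterPath [] = inj₂ ([] , [] ∷ [] , ℤP.≤-refl , λ h → h)
  negativeCycle⊎shorterPath {x} (e ∷ w) with negativeCycle⊎shorterPath w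
  ... | inj₁ cycle = inj₁ cycle
  ... | inj₂ (p , p-path , p≤w , p⊆w) with x ∈? vertices p
  ...   | no x∉p = inj₂ ( e ∷ p , ¬Any⇒All¬ _ x∉p ∷ p-path , ℤP.+-monoʳ-≤ (κ e) p≤w
                        , λ { here → here ; (there h) → there (p⊆w h) })
  ...   | yes x∈p with splitAt p p-path x∈p
  ...     | split with κ e + weight (Split.prefix split) ℤ.<? 0ℤ
  ...       | yes cycle<0 =
    inj₁ (record { edge = e ; back = prefix ; back-path = prefix-path ; negative = cycle<0 })
    where open Split split
  ...       | no cycle≮0 = inj₂ (suffix , suffix-path , suffix≤ , there ∘ p⊆w ∘ suffix⊆)
    where
      open Split split
      open ℤP.≤-Reasoning
      suffix≤ : weight suffix ℤ.≤ κ e + weight w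
      suffix≤ = begin
        weight suffix                           ≡⟨ ℤP.+-identityˡ _ ⟨
        0ℤ + weight suffix                      ≤⟨ ℤP.+-monoˡ-≤ (weight suffix) (ℤP.≮⇒≥ cycle≮0) ⟩
        (κ e + weight prefix) + weight suffix   ≡⟨ ℤP.+-assoc (κ e) _ _ ⟩
        κ e + (weight prefix + weight suffix)   ≡⟨ cong (_+_ (κ e)) weight-split ⟩
        κ e + weight p                          ≤⟨ ℤP.+-monoʳ-≤ (κ e) p≤w ⟩
        κ e + weight w                          ∎

module _ {n : ℕ} {E : Graph n} where

  open WeightedWalks {E = E} (λ _ → 0ℤ)

  -- With all weights zero no cycle is negative, so only the shortcutting remains.
  shortcut : ∀ {x y} (w : Walk E x y) → Σ (Walk E x y) λ p → IsPath p × p ⊆ᵉ w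
  shortcut w with negativeCycle⊎shorterPath w
  ... | inj₁ cycle = ⊥-elim (ℤP.<⇒≱ negative (weight-nonneg (λ _ → ℤP.≤-refl) (edge ∷ back)))
    where open NegativeCycle cycle
  ... | inj₂ (p , p-path , _ , p⊆w) = p , p-path , p⊆w

module DecLists {A : Set} (_≟_ : DecidableEquality A) where

  sumBy : (A → ℤ) → List A → ℤ
  sumBy f []       = 0ℤ
  sumBy f (x ∷ xs) = f x + sumBy f xs

  sumBy-++ : ∀ f xs ys → sumBy f (xs ++ ys) ≡ sumBy f xs + sumBy f ys
  sumBy-++ f []       ys = sym (ℤP.+-identityˡ _)
  sumBy-++ f (x ∷ xs) ys =
    trans (cong (_+_ (f x)) (sumBy-++ f xs ys)) (sym (ℤP.+-assoc (f x) _ _))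

  remove : A → List A → List A
  remove e [] = []
  remove e (x ∷ xs) with x ≟ e
  ... | yes _ = xs
  ... | no _  = x ∷ remove e xs

  ∈-remove⁻ : ∀ {z} e xs → z ∈ remove e xs → z ∈ xs
  ∈-remove⁻ e (x ∷ xs) z∈ with x ≟ e | z∈
  ... | yes _ | h         = there h
  ... | no _  | here z≡x  = here z≡x
  ... | no _  | there h   = there (∈-remove⁻ e xs h)

  ∈-remove⁺ : ∀ {z} e xs → z ∈ xs → z ≢ e → z ∈ remove e xs
  ∈-remove⁺ e (x ∷ xs) z∈ z≢e with x ≟ e | z∈
  ... | yes refl | here refl = ⊥-elim (z≢e refl)
  ... | yes _    | there h   = h
  ... | no _     | here z≡x  = here z≡x
  ... | no _     | there h   = there (∈-remove⁺ e xs h z≢e)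

  ∉-remove : ∀ e {xs} → Unique xs → e ∉ remove e xs
  ∉-remove e {x ∷ xs} (x∉xs ∷ xs!) e∈ with x ≟ e | e∈
  ... | yes refl | h         = All.lookup x∉xs h refl
  ... | no x≢e   | here e≡x  = x≢e (sym e≡x)
  ... | no _     | there h   = ∉-remove e xs! h

  remove-unique : ∀ e {xs} → Unique xs → Unique (remove e xs)
  remove-unique e {[]}     xs! = xs!
  remove-unique e {x ∷ xs} (x∉xs ∷ xs!) with x ≟ e
  ... | yes _ = xs!
  ... | no _  = All.tabulate (All.lookup x∉xs ∘ ∈-remove⁻ e xs) ∷ remove-unique e xs!

  length-remove : ∀ {e} xs → e ∈ xs → length xs ≡ suc (length (remove e xs))
  length-remove {e} (x ∷ xs) e∈ with x ≟ e | e∈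
  ... | yes _  | _        = refl
  ... | no x≢e | here e≡x = ⊥-elim (x≢e (sym e≡x))
  ... | no _   | there h  = cong suc (length-remove xs h)

  sumBy-remove : ∀ f {e} xs → e ∈ xs → sumBy f (remove e xs) ≡ sumBy f xs - f e
  sumBy-remove f {e} (x ∷ xs) e∈ with x ≟ e | e∈
  ... | yes refl | _        = sym ([x+y]-x≡y (f x) (sumBy f xs))
  ... | no x≢e   | here e≡x = ⊥-elim (x≢e (sym e≡x))
  ... | no _     | there h  =
    trans (cong (_+_ (f x)) (sumBy-remove f xs h)) (sym (ℤP.+-assoc (f x) _ _))

  removeAll : List A → List A → List A
  removeAll []       xs = xs
  removeAll (e ∷ es) xs = remove e (removeAll es xs)

  ∈-removeAll⁻ : ∀ {z} es xs → z ∈ removeAll es xs → z ∈ xs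
  ∈-removeAll⁻ []       xs h = h
  ∈-removeAll⁻ (e ∷ es) xs h = ∈-removeAll⁻ es xs (∈-remove⁻ e (removeAll es xs) h)

  ∈-removeAll⁺ : ∀ {z} es xs → z ∈ xs → z ∉ es → z ∈ removeAll es xs
  ∈-removeAll⁺ []       xs z∈ _   = z∈
  ∈-removeAll⁺ (e ∷ es) xs z∈ z∉ =
    ∈-remove⁺ e (removeAll es xs) (∈-removeAll⁺ es xs z∈ (z∉ ∘ there)) (z∉ ∘ here)

  removeAll-unique : ∀ es {xs} → Unique xs → Unique (removeAll es xs)
  removeAll-unique []       xs! = xs!
  removeAll-unique (e ∷ es) xs! = remove-unique e (removeAll-unique es xs!)

  ∉-removeAll : ∀ {z} es {xs} → Unique xs → z ∈ es → z ∉ removeAll es xs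
  ∉-removeAll (e ∷ es) xs! (here refl) = ∉-remove e (removeAll-unique es xs!)
  ∉-removeAll (e ∷ es) xs! (there z∈)  = ∉-removeAll es xs! z∈ ∘ ∈-remove⁻ e _

  sumBy-removeAll : ∀ f es xs → (∀ {z} → z ∈ es → z ∈ xs) → Unique es →
                    sumBy f (removeAll es xs) ≡ sumBy f xs - sumBy f es
  sumBy-removeAll f []       xs _     _             = sym (ℤP.+-identityʳ _)
  sumBy-removeAll f (e ∷ es) xs es⊆xs (e∉es ∷ es!) = begin
    sumBy f (remove e (removeAll es xs))  ≡⟨ sumBy-remove f (removeAll es xs) e∈ ⟩
    sumBy f (removeAll es xs) - f e       ≡⟨ cong (_- f e) (sumBy-removeAll f es xs (es⊆xs ∘ there) es!) ⟩
    (sumBy f xs - sumBy f es) - f e       ≡⟨ [x-y]-z≡x-[z+y] (sumBy f xs) (sumBy f es) (f e) ⟩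
    sumBy f xs - (f e + sumBy f es)       ∎
    where
      open ≡-Reasoning
      e∈ : e ∈ removeAll es xs
      e∈ = ∈-removeAll⁺ es xs (es⊆xs (here refl)) (λ h → All.lookup e∉es h refl)

  concatFin : ∀ {k} → (Fin k → List A) → List A
  concatFin {zero}  xss = []
  concatFin {suc k} xss = xss zero ++ concatFin (xss ∘ suc)

  ∈-concatFin⁺ : ∀ {k} (xss : Fin k → List A) a {z} → z ∈ xss a → z ∈ concatFin xss
  ∈-concatFin⁺ xss zero    h = ∈-++⁺ˡ h
  ∈-concatFin⁺ xss (suc a) h = ∈-++⁺ʳ (xss zero) (∈-concatFin⁺ (xss ∘ suc) a h)

  ∈-concatFin⁻ : ∀ {k} (xss : Fin k → List A) {z} → z ∈ concatFin xss → ∃ λ a → z ∈ xss a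
  ∈-concatFin⁻ {suc k} xss h with ∈-++⁻ (xss zero) h
  ... | inj₁ h₀ = zero , h₀
  ... | inj₂ h₁ = let a , h′ = ∈-concatFin⁻ (xss ∘ suc) h₁ in suc a , h′

  concatFin-unique : ∀ {k} (xss : Fin k → List A) → (∀ a → Unique (xss a)) →
                     (∀ a b → a ≢ b → ∀ {z} → z ∈ xss a → z ∈ xss b → ⊥) →
                     Unique (concatFin xss)
  concatFin-unique {zero}  xss _    _        = []
  concatFin-unique {suc k} xss xss! disjoint =
    Unique.++⁺ (xss! zero)
      (concatFin-unique (xss ∘ suc) (xss! ∘ suc)
        λ a b a≢b → disjoint (suc a) (suc b) (a≢b ∘ suc-injective))
      λ (h₀ , h₁) → let b , h = ∈-concatFin⁻ (xss ∘ suc) h₁ in disjoint zero (suc b) (λ ()) h₀ h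

  sumBy-concatFin-const : ∀ f {k} (xss : Fin k → List A) {d} → (∀ a → sumBy f (xss a) ≡ d) →
                          sumBy f (concatFin xss) ≡ + k * d
  sumBy-concatFin-const f {zero}  xss {d} _    = sym (ℤP.*-zeroˡ d)
  sumBy-concatFin-const f {suc k} xss {d} sums = begin
    sumBy f (xss zero ++ concatFin (xss ∘ suc))           ≡⟨ sumBy-++ f (xss zero) _ ⟩
    sumBy f (xss zero) + sumBy f (concatFin (xss ∘ suc))  ≡⟨ cong₂ _+_ (sums zero) rest ⟩
    d + + k * d                                           ≡⟨ ℤP.suc-* (+ k) d ⟨
    + suc k * d                                           ∎
    where
      open ≡-Reasoning
      rest : sumBy f (concatFin (xss ∘ suc)) ≡ + k * d
      rest = sumBy-concatFin-const f (xss ∘ suc) (sums ∘ suc)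

  sumBy-concatFin-sumFin : ∀ f {k} (xss : Fin k → List A) (h : Fin k → ℕ) →
                           (∀ a → sumBy f (xss a) ≡ + h a) → sumBy f (concatFin xss) ≡ + sumFin h
  sumBy-concatFin-sumFin f {zero}  xss h _    = refl
  sumBy-concatFin-sumFin f {suc k} xss h sums =
    trans (sumBy-++ f (xss zero) _)
          (cong₂ _+_ (sums zero) (sumBy-concatFin-sumFin f (xss ∘ suc) (h ∘ suc) (sums ∘ suc)))

module EdgeFlows {n : ℕ} where

  Edge : Set
  Edge = Fin n × Fin n

  open DecLists (≡-dec (Fin._≟_ {n}) (Fin._≟_ {n})) public

  δ : Fin n → Fin n → ℤ
  δ v a with v Fin.≟ a
  ... | yes _ = 1ℤ
  ... | no _  = 0ℤ

  δ-refl : ∀ v → δ v v ≡ 1ℤ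
  δ-refl v with v Fin.≟ v
  ... | yes _  = refl
  ... | no v≢v = ⊥-elim (v≢v refl)

  δ-≢ : ∀ {v a} → v ≢ a → δ v a ≡ 0ℤ
  δ-≢ {v} {a} v≢a with v Fin.≟ a
  ... | yes v≡a = ⊥-elim (v≢a v≡a)
  ... | no _    = refl

  δ-nonneg : ∀ v a → 0ℤ ℤ.≤ δ v a
  δ-nonneg v a with v Fin.≟ a
  ... | yes _ = ℤ.+≤+ ℕ.z≤n
  ... | no _  = ℤ.+≤+ ℕ.z≤n

  net : Fin n → Edge → ℤ
  net v (a , b) = δ v a - δ v b

  net-tail : ∀ {v u} → v ≢ u → net v (v , u) ≡ 1ℤ
  net-tail {v} v≢u rewrite δ-refl v | δ-≢ v≢u = refl

  net-head : ∀ {v u} → u ≢ v → net u (v , u) ≡ - 1ℤ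
  net-head {u = u} u≢v rewrite δ-refl u | δ-≢ u≢v = refl

  net-elsewhere : ∀ {y v u} → y ≢ v → y ≢ u → net y (v , u) ≡ 0ℤ
  net-elsewhere y≢v y≢u rewrite δ-≢ y≢v | δ-≢ y≢u = refl

  net-nonpos : ∀ {v a} b → v ≢ a → net v (a , b) ℤ.≤ 0ℤ
  net-nonpos {v} b v≢a rewrite δ-≢ v≢a with v Fin.≟ b
  ... | yes _ = ℤ.-≤+
  ... | no _  = ℤ.+≤+ ℕ.z≤n

  netFlow : List Edge → Fin n → ℤ
  netFlow L v = sumBy (net v) L

  IsFlow : Fin n → Fin n → ℕ → List Edge → Set
  IsFlow s t k L = ∀ v → netFlow L v ≡ + k * (δ v s - δ v t)

  edgeCost : (Fin n → Fin n → ℕ) → Edge → ℤ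
  edgeCost c (a , b) = + c a b

  listCost : (Fin n → Fin n → ℕ) → List Edge → ℤ
  listCost c = sumBy (edgeCost c)

  listCost-nonneg : ∀ c L → 0ℤ ℤ.≤ listCost c L
  listCost-nonneg c []      = ℤP.≤-refl
  listCost-nonneg c (e ∷ L) = ℤP.+-mono-≤ (ℤ.+≤+ ℕ.z≤n) (listCost-nonneg c L)

  module _ {E : Graph n} where

    edges : ∀ {x y} → Walk E x y → List Edge
    edges []                    = []
    edges {x} (_∷_ {y = y} e w) = (x , y) ∷ edges w

    EdgeIn⇒∈edges : ∀ {u v x y} {w : Walk E x y} → EdgeIn u v w → (u , v) ∈ edges w
    EdgeIn⇒∈edges here      = here refl
    EdgeIn⇒∈edges (there h) = there (EdgeIn⇒∈edges h)

    ∈edges⇒EdgeIn : ∀ {u v x y} (w : Walk E x y) → (u , v) ∈ edges w → EdgeIn u v w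
    ∈edges⇒EdgeIn (e ∷ w) (here refl) = here
    ∈edges⇒EdgeIn (e ∷ w) (there h)   = there (∈edges⇒EdgeIn w h)

    _⊆ᴸ_ : ∀ {x y} → Walk E x y → List Edge → Set
    w ⊆ᴸ L = ∀ {a b} → EdgeIn a b w → (a , b) ∈ L

    ⊆ᴸ⇒edges⊆ : ∀ {x y L} (w : Walk E x y) → w ⊆ᴸ L → ∀ {e} → e ∈ edges w → e ∈ L
    ⊆ᴸ⇒edges⊆ w w⊆L {a , b} = w⊆L ∘ ∈edges⇒EdgeIn w

    ∈edges⇒∈tails : ∀ {a b x y} (w : Walk E x y) → (a , b) ∈ edges w → a ∈ tails w
    ∈edges⇒∈tails (e ∷ w) (here refl) = here refl
    ∈edges⇒∈tails (e ∷ w) (there h)   = there (∈edges⇒∈tails w h)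

    path⇒edges-unique : ∀ {x y} (w : Walk E x y) → IsPath w → Unique (edges w)
    path⇒edges-unique w = tails-unique⇒edges-unique ∘ path⇒tails-unique w
      where
        tails-unique⇒edges-unique : ∀ {x y} {w : Walk E x y} → Unique (tails w) → Unique (edges w)
        tails-unique⇒edges-unique {w = []}    _          = []
        tails-unique⇒edges-unique {w = e ∷ w} (x∉w ∷ w!) =
          All.tabulate (λ { h refl → All.lookup x∉w (∈edges⇒∈tails w h) refl })
          ∷ tails-unique⇒edges-unique w!

    netFlow-edges : ∀ {x y} (w : Walk E x y) v → netFlow (edges w) v ≡ δ v x - δ v y
    netFlow-edges {x} []      v = sym (ℤP.+-inverseʳ (δ v x))
    netFlow-edges {x} {z} (_∷_ {y = y} e w) v =
      trans (cong (_+_ (δ v x - δ v y)) (netFlow-edges w v)) (ℤP.+-minus-telescope (δ v x) (δ v y) (δ v z))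

    listCost-edges : ∀ c {x y} (w : Walk E x y) → listCost c (edges w) ≡ + costℕ c w
    listCost-edges c []                    = refl
    listCost-edges c {x} (_∷_ {y = y} e w) = cong (_+_ (+ c x y)) (listCost-edges c w)

module FlowDecomposition {n : ℕ} (G : Graph n) (c : Fin n → Fin n → ℕ) (anti : AntiSymmetric G) where

  open EdgeFlows {n}

  InGraph : List Edge → Set
  InGraph L = ∀ {a b} → (a , b) ∈ L → G a b

  WalkWithin : List Edge → Fin n → Fin n → Set
  WalkWithin L x y = Σ (Walk G x y) (_⊆ᴸ L)

  outEdge : ∀ L {v} → 0ℤ ℤ.< netFlow L v → ∃ λ u → (v , u) ∈ L
  outEdge []            (ℤ.+<+ ())
  outEdge ((a , b) ∷ L) {v} v>0 = fromTail (v Fin.≟ a)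
    where
      fromTail : Dec (v ≡ a) → ∃ λ u → (v , u) ∈ (a , b) ∷ L
      fromTail (yes refl) = b , here refl
      fromTail (no v≢a)   =
        let u , vu∈L = outEdge L (ℤP.<-≤-trans v>0 netFlow-drops) in u , there vu∈L
        where
          netFlow-drops : netFlow ((a , b) ∷ L) v ℤ.≤ netFlow L v
          netFlow-drops = ℤP.≤-trans (ℤP.+-monoˡ-≤ (netFlow L v) (net-nonpos b v≢a))
                                     (ℤP.≤-reflexive (ℤP.+-identityˡ _))

  -- Removing (v , u) lowers the net flow only at v, by one, and v had positive excess.
  deficit-persists : ∀ {L v u y} → (v , u) ∈ L → v ≢ u → 0ℤ ℤ.< netFlow L v →
                     0ℤ ℤ.< netFlow (remove (v , u) L) u → netFlow (remove (v , u) L) y ℤ.< 0ℤ →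
                     netFlow L y ℤ.< 0ℤ
  deficit-persists {L} {v} {u} {y} vu∈L v≢u v>0 u>0 y<0 with y Fin.≟ u | y Fin.≟ v
  ... | yes refl | _        = ⊥-elim (ℤP.<-asym y<0 u>0)
  ... | no _     | yes refl = ⊥-elim (ℤP.<⇒≱ y<0 (subst (0ℤ ℤ.≤_) (sym v-decreases) v-1≥0))
    where
      v-decreases : netFlow (remove (v , u) L) v ≡ netFlow L v - 1ℤ
      v-decreases = trans (sumBy-remove (net v) L vu∈L) (cong (_-_ (netFlow L v)) (net-tail v≢u))
      v-1≥0 : 0ℤ ℤ.≤ netFlow L v - 1ℤ
      v-1≥0 = ℤP.i≤j⇒0≤j-i (ℤP.i<j⇒suc[i]≤j v>0)
  ... | no y≢u   | no y≢v   = subst (ℤ._< 0ℤ) y-unchanged y<0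
    where
      y-unchanged : netFlow (remove (v , u) L) y ≡ netFlow L y
      y-unchanged = trans (sumBy-remove (net y) L vu∈L)
                          (trans (cong (_-_ (netFlow L y)) (net-elsewhere y≢v y≢u)) (ℤP.+-identityʳ _))

  walkToDeficit : ∀ m L → length L ≡ m → InGraph L → ∀ {v} → 0ℤ ℤ.< netFlow L v →
                  ∃ λ y → netFlow L y ℤ.< 0ℤ × WalkWithin L v y
  walkToDeficit zero    []      _       _   (ℤ.+<+ ())
  walkToDeficit zero    (_ ∷ _) ()      _   _
  walkToDeficit (suc m) L       length≡ L⊆G {v} v>0 with outEdge L v>0
  ... | u , vu∈L with netFlow L u ℤ.<? 0ℤ
  ...   | yes u<0 = u , u<0 , (L⊆G vu∈L ∷ []) , λ { here → vu∈L ; (there ()) }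
  ...   | no u≮0  =
    let y , y<0 , w , w⊆L′ = walkToDeficit m L′ length′ (L⊆G ∘ ∈-remove⁻ (v , u) L) u>0
    in  y , deficit-persists {y = y} vu∈L v≢u v>0 u>0 y<0 , (L⊆G vu∈L ∷ w)
          , λ { here → vu∈L ; (there h) → ∈-remove⁻ (v , u) L (w⊆L′ h) }
    where
      L′ : List Edge
      L′ = remove (v , u) L

      v≢u : v ≢ u
      v≢u refl = anti v v (L⊆G vu∈L) (L⊆G vu∈L)

      length′ : length L′ ≡ m
      length′ = ℕP.suc-injective (trans (sym (length-remove L vu∈L)) length≡)

      u-increases : netFlow L′ u ≡ netFlow L u + 1ℤ
      u-increases = trans (sumBy-remove (net u) L vu∈L) (cong (_-_ (netFlow L u)) (net-head (v≢u ∘ sym)))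

      u>0 : 0ℤ ℤ.< netFlow L′ u
      u>0 = subst (0ℤ ℤ.<_) (sym u-increases)
                  (ℤP.+-mono-≤-< (ℤP.≮⇒≥ u≮0) (ℤ.+<+ (ℕ.s≤s ℕ.z≤n)))

  module _ {s t : Fin n} (s≢t : s ≢ t) where

    source-excess : ∀ {k L} → IsFlow s t (suc k) L → 0ℤ ℤ.< netFlow L s
    source-excess {k} {L} flow rewrite flow s | δ-refl s | δ-≢ s≢t | ℤP.*-identityʳ (+ suc k) =
      ℤ.+<+ (ℕ.s≤s ℕ.z≤n)

    no-deficit-off-sink : ∀ {k L y} → IsFlow s t k L → y ≢ t → 0ℤ ℤ.≤ netFlow L y
    no-deficit-off-sink {k} {L} {y} flow y≢t rewrite flow y | δ-≢ y≢t | ℤP.+-identityʳ (δ y s) =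
      subst (ℤ._≤ + k * δ y s) (ℤP.*-zeroʳ (+ k)) (ℤP.*-monoˡ-≤-nonNeg (+ k) (δ-nonneg y s))

    flowPath : ∀ {k L} → InGraph L → IsFlow s t (suc k) L → Σ (Walk G s t) λ p → IsPath p × p ⊆ᴸ L
    flowPath {k} {L} L⊆G flow with walkToDeficit _ L refl L⊆G (source-excess {k} {L} flow)
    ... | y , y<0 , w , w⊆L with y Fin.≟ t
    ...   | no y≢t   = ⊥-elim (ℤP.<⇒≱ y<0 (no-deficit-off-sink {suc k} {L} flow y≢t))
    ...   | yes refl = let p , p-path , p⊆w = shortcut w in p , p-path , w⊆L ∘ p⊆w

    peel-flow : ∀ {k L} (p : Walk G s t) → IsPath p → p ⊆ᴸ L →
                IsFlow s t (suc k) L → IsFlow s t k (removeAll (edges p) L)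
    peel-flow {k} {L} p p-path p⊆L flow v = begin
      netFlow (removeAll (edges p) L) v   ≡⟨ sumBy-removeAll (net v) (edges p) L
                                               (⊆ᴸ⇒edges⊆ p p⊆L) (path⇒edges-unique p p-path) ⟩
      netFlow L v - netFlow (edges p) v   ≡⟨ cong₂ _-_ (flow v) (netFlow-edges p v) ⟩
      + suc k * d - d                     ≡⟨ cong (_- d) (ℤP.suc-* (+ k) d) ⟩
      (d + + k * d) - d                   ≡⟨ [x+y]-x≡y d (+ k * d) ⟩
      + k * d                             ∎
      where
        open ≡-Reasoning
        d : ℤ
        d = δ v s - δ v t

    record Decomposition (k : ℕ) (L : List Edge) : Set where
      field
        paths  : Fin k → Walk G s t
        family : IsPathFamily paths
        cost≤  : + familyCost c paths ℤ.≤ listCost c L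
        ⊆L     : ∀ a → paths a ⊆ᴸ L

    extend : ∀ {k L} → Unique L → (p : Walk G s t) → IsPath p → p ⊆ᴸ L →
             Decomposition k (removeAll (edges p) L) → Decomposition (suc k) L
    extend {k} {L} L! p p-path p⊆L rest = record
      { paths  = Q
      ; family = Q-paths , Q-disjoint
      ; cost≤  = Q-cost
      ; ⊆L     = Q⊆L
      }
      where
        open Decomposition rest renaming (paths to P; family to P-family; cost≤ to P-cost; ⊆L to P⊆L′)
        L′ : List Edge
        L′ = removeAll (edges p) L

        Q : Fin (suc k) → Walk G s t
        Q zero    = p
        Q (suc a) = P a

        Q-paths : ∀ a → IsPath (Q a)
        Q-paths zero    = p-path
        Q-paths (suc a) = proj₁ P-family a

        Q⊆L : ∀ a → Q a ⊆ᴸ L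
        Q⊆L zero    = p⊆L
        Q⊆L (suc a) = ∈-removeAll⁻ (edges p) L ∘ P⊆L′ a

        p-avoids : ∀ a {u v} → EdgeIn u v p → EdgeIn u v (P a) → ⊥
        p-avoids a h₁ h₂ = ∉-removeAll (edges p) L! (EdgeIn⇒∈edges h₁) (P⊆L′ a h₂)

        Q-disjoint : EdgeDisjoint Q
        Q-disjoint zero    zero    0≢0 = ⊥-elim (0≢0 refl)
        Q-disjoint zero    (suc b) _   u v h₁ h₂ = p-avoids b h₁ h₂
        Q-disjoint (suc a) zero    _   u v h₁ h₂ = p-avoids a h₂ h₁
        Q-disjoint (suc a) (suc b) a≢b = proj₂ P-family a b (a≢b ∘ cong suc)

        Q-cost : + familyCost c Q ℤ.≤ listCost c L
        Q-cost = begin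
          + costℕ c p + + familyCost c P          ≤⟨ ℤP.+-monoʳ-≤ (+ costℕ c p) P-cost ⟩
          + costℕ c p + listCost c L′             ≡⟨ cong₂ _+_ (sym (listCost-edges c p)) L′-cost ⟩
          lp + (listCost c L - lp)                ≡⟨ x+[y-x]≡y lp (listCost c L) ⟩
          listCost c L                            ∎
          where
            open ℤP.≤-Reasoning
            lp : ℤ
            lp = listCost c (edges p)
            L′-cost : listCost c L′ ≡ listCost c L - lp
            L′-cost = sumBy-removeAll (edgeCost c) (edges p) L
                        (⊆ᴸ⇒edges⊆ p p⊆L) (path⇒edges-unique p p-path)

    decompose : ∀ k L → Unique L → InGraph L → IsFlow s t k L → Decomposition k L
    decompose zero    L _  _   _    = record
      { paths = λ () ; family = (λ ()) , (λ ()) ; cost≤ = listCost-nonneg c L ; ⊆L = λ () }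
    decompose (suc k) L L! L⊆G flow =
      let p , p-path , p⊆L = flowPath {k} L⊆G flow
      in  extend L! p p-path p⊆L
            (decompose k (removeAll (edges p) L) (removeAll-unique (edges p) L!)
               (L⊆G ∘ ∈-removeAll⁻ (edges p) L) (peel-flow {k} p p-path p⊆L flow))

module MinCostFamily {n : ℕ} (G : Graph n) (c : Fin n → Fin n → ℕ) (anti : AntiSymmetric G)
                     {s t : Fin n} (s≢t : s ≢ t)
                     {k : ℕ} (S : Fin k → Walk G s t) (S-family : IsPathFamily S) where

  open EdgeFlows {n}
  open FlowDecomposition G c anti

  L₀ : List Edge
  L₀ = concatFin (edges ∘ S)

  L₀-unique : Unique L₀
  L₀-unique = concatFin-unique (edges ∘ S) (λ a → path⇒edges-unique (S a) (proj₁ S-family a))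
    λ { a b a≢b {u , v} h₁ h₂ →
          proj₂ S-family a b a≢b u v (∈edges⇒EdgeIn (S a) h₁) (∈edges⇒EdgeIn (S b) h₂) }

  EdgeSetOf⇒∈L₀ : ∀ {u v} → EdgeSetOf S u v → (u , v) ∈ L₀
  EdgeSetOf⇒∈L₀ (a , h) = ∈-concatFin⁺ (edges ∘ S) a (EdgeIn⇒∈edges h)

  ∈L₀⇒EdgeSetOf : ∀ {u v} → (u , v) ∈ L₀ → EdgeSetOf S u v
  ∈L₀⇒EdgeSetOf h = let a , h′ = ∈-concatFin⁻ (edges ∘ S) h in a , ∈edges⇒EdgeIn (S a) h′

  L₀-inGraph : InGraph L₀
  L₀-inGraph = EdgeIn⇒edge ∘ proj₂ ∘ ∈L₀⇒EdgeSetOf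

  L₀-flow : IsFlow s t k L₀
  L₀-flow v = sumBy-concatFin-const (net v) (edges ∘ S) (λ a → netFlow-edges (S a) v)

  L₀-cost : listCost c L₀ ≡ + familyCost c S
  L₀-cost = sumBy-concatFin-sumFin (edgeCost c) (edges ∘ S) (λ a → costℕ c (S a))
                                   (λ a → listCost-edges c (S a))

  Residual : Graph n
  Residual u v = (G u v × (u , v) ∉ L₀) ⊎ (v , u) ∈ L₀

  residualCost : ∀ {u v} → Residual u v → ℤ
  residualCost {u} {v} (inj₁ _) = + c u v
  residualCost {u} {v} (inj₂ _) = - + c v u

  open WeightedWalks {E = Residual} residualCost

  forward : ∀ {x y} → Walk Residual x y → List Edge
  forward []                           = []
  forward {x} (_∷_ {y = u} (inj₁ _) w) = (x , u) ∷ forward w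
  forward     (inj₂ _ ∷ w)             = forward w

  backward : ∀ {x y} → Walk Residual x y → List Edge
  backward []                           = []
  backward     (inj₁ _ ∷ w)             = backward w
  backward {x} (_∷_ {y = u} (inj₂ _) w) = (u , x) ∷ backward w

  augment : ∀ {x y} → Walk Residual x y → List Edge
  augment []                           = L₀
  augment {x} (_∷_ {y = u} (inj₁ _) w) = (x , u) ∷ augment w
  augment {x} (_∷_ {y = u} (inj₂ _) w) = remove (u , x) (augment w)

  ∈forward⇒∈tails : ∀ {x y a b} (w : Walk Residual x y) → (a , b) ∈ forward w → a ∈ tails w
  ∈forward⇒∈tails (inj₁ _ ∷ w) (here refl) = here refl
  ∈forward⇒∈tails (inj₁ _ ∷ w) (there h)   = there (∈forward⇒∈tails w h)
  ∈forward⇒∈tails (inj₂ _ ∷ w) h           = there (∈forward⇒∈tails w h)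

  ∈backward⇒∈tails : ∀ {x y a b} (w : Walk Residual x y) → (a , b) ∈ backward w → b ∈ tails w
  ∈backward⇒∈tails (inj₁ _ ∷ w) h           = there (∈backward⇒∈tails w h)
  ∈backward⇒∈tails (inj₂ _ ∷ w) (here refl) = here refl
  ∈backward⇒∈tails (inj₂ _ ∷ w) (there h)   = there (∈backward⇒∈tails w h)

  forward-inGraph : ∀ {x y} (w : Walk Residual x y) → InGraph (forward w)
  forward-inGraph (inj₁ (g , _) ∷ w) (here refl) = g
  forward-inGraph (inj₁ _ ∷ w)       (there h)   = forward-inGraph w h
  forward-inGraph (inj₂ _ ∷ w)       h           = forward-inGraph w h

  ∈augment⁻ : ∀ {x y z} (w : Walk Residual x y) → z ∈ augment w → z ∈ L₀ ⊎ z ∈ forward w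
  ∈augment⁻ []           h           = inj₁ h
  ∈augment⁻ (inj₁ _ ∷ w) (here refl) = inj₂ (here refl)
  ∈augment⁻ (inj₁ _ ∷ w) (there h)   = Sum.map₂ there (∈augment⁻ w h)
  ∈augment⁻ {x} (_∷_ {y = u} (inj₂ _) w) h = ∈augment⁻ w (∈-remove⁻ (u , x) (augment w) h)

  ∈augment⁺ : ∀ {x y z} (w : Walk Residual x y) → z ∈ L₀ → z ∉ backward w → z ∈ augment w
  ∈augment⁺ []           h _   = h
  ∈augment⁺ (inj₁ _ ∷ w) h z∉w = there (∈augment⁺ w h z∉w)
  ∈augment⁺ {x} (_∷_ {y = u} (inj₂ _) w) h z∉w =
    ∈-remove⁺ (u , x) (augment w) (∈augment⁺ w h (z∉w ∘ there)) (z∉w ∘ here)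

  cancelled∈augment : ∀ {x u y} (w : Walk Residual u y) → (u , x) ∈ L₀ → x ∉ tails w →
                      (u , x) ∈ augment w
  cancelled∈augment w ux∈L₀ x∉w = ∈augment⁺ w ux∈L₀ (x∉w ∘ ∈backward⇒∈tails w)

  augment-unique : ∀ {x y} (w : Walk Residual x y) → Unique (tails w) → Unique (augment w)
  augment-unique []      _            = L₀-unique
  augment-unique {x} (_∷_ {y = u} (inj₁ (_ , xu∉L₀)) w) (x∉w ∷ w!) =
    All.tabulate (λ { h refl → xu∉augment h }) ∷ augment-unique w w!
    where
      xu∉augment : (x , u) ∉ augment w
      xu∉augment h with ∈augment⁻ w h
      ... | inj₁ xu∈L₀ = xu∉L₀ xu∈L₀
      ... | inj₂ xu∈fw = All.lookup x∉w (∈forward⇒∈tails w xu∈fw) refl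
  augment-unique {x} (_∷_ {y = u} (inj₂ _) w) (_ ∷ w!) = remove-unique (u , x) (augment-unique w w!)

  netFlow-augment : ∀ {x y} (w : Walk Residual x y) → Unique (tails w) → ∀ v →
                    netFlow (augment w) v ≡ netFlow L₀ v + (δ v x - δ v y)
  netFlow-augment {x} [] _ v =
    sym (trans (cong (_+_ (netFlow L₀ v)) (ℤP.+-inverseʳ (δ v x))) (ℤP.+-identityʳ _))
  netFlow-augment {x} {y} (_∷_ {y = u} (inj₁ _) w) (_ ∷ w!) v = begin
    (δ v x - δ v u) + netFlow (augment w) v            ≡⟨ cong (_+_ (δ v x - δ v u)) (netFlow-augment w w! v) ⟩
    (δ v x - δ v u) + (netFlow L₀ v + (δ v u - δ v y))  ≡⟨ telescope (δ v x) (δ v u) (netFlow L₀ v) (δ v y) ⟩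
    netFlow L₀ v + (δ v x - δ v y)                      ∎
    where
      open ≡-Reasoning
      telescope : ∀ a b f d → (a - b) + (f + (b - d)) ≡ f + (a - d)
      telescope = solve-∀
  netFlow-augment {x} {y} (_∷_ {y = u} (inj₂ ux∈L₀) w) (x∉w ∷ w!) v = begin
    netFlow (remove (u , x) (augment w)) v                ≡⟨ sumBy-remove (net v) (augment w) ux∈augment ⟩
    netFlow (augment w) v - (δ v u - δ v x)               ≡⟨ cong (_- (δ v u - δ v x)) (netFlow-augment w w! v) ⟩
    (netFlow L₀ v + (δ v u - δ v y)) - (δ v u - δ v x)    ≡⟨ telescope (netFlow L₀ v) (δ v u) (δ v y) (δ v x) ⟩
    netFlow L₀ v + (δ v x - δ v y)                        ∎
    where
      open ≡-Reasoning
      ux∈augment : (u , x) ∈ augment w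
      ux∈augment = cancelled∈augment w ux∈L₀ (All¬⇒¬Any x∉w)
      telescope : ∀ f b d a → (f + (b - d)) - (b - a) ≡ f + (a - d)
      telescope = solve-∀

  listCost-augment : ∀ {x y} (w : Walk Residual x y) → Unique (tails w) →
                     listCost c (augment w) ≡ listCost c L₀ + weight w
  listCost-augment [] _ = sym (ℤP.+-identityʳ _)
  listCost-augment {x} (_∷_ {y = u} (inj₁ _) w) (_ ∷ w!) =
    trans (cong (_+_ (+ c x u)) (listCost-augment w w!)) (swap (+ c x u) (listCost c L₀) (weight w))
    where
      swap : ∀ a b d → a + (b + d) ≡ b + (a + d)
      swap = solve-∀
  listCost-augment {x} (_∷_ {y = u} (inj₂ ux∈L₀) w) (x∉w ∷ w!) = begin
    listCost c (remove (u , x) (augment w))   ≡⟨ sumBy-remove (edgeCost c) (augment w) ux∈augment ⟩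
    listCost c (augment w) - + c u x           ≡⟨ cong (_- + c u x) (listCost-augment w w!) ⟩
    (listCost c L₀ + weight w) - + c u x       ≡⟨ move (listCost c L₀) (weight w) (+ c u x) ⟩
    listCost c L₀ + (- + c u x + weight w)     ∎
    where
      open ≡-Reasoning
      ux∈augment : (u , x) ∈ augment w
      ux∈augment = cancelled∈augment w ux∈L₀ (All¬⇒¬Any x∉w)
      move : ∀ a b d → (a + b) - d ≡ a + (- d + b)
      move = solve-∀

  reverseOnto : ∀ {a b z} (B : Walk G a b) → B ⊆ᴸ L₀ →
                (acc : Walk Residual a z) → Σ (Walk Residual b z) λ r → weight r ℤ.≤ weight acc
  reverseOnto []      _    acc = acc , ℤP.≤-refl
  reverseOnto (e ∷ B) B⊆L₀ acc =
    let r , r≤ = reverseOnto B (B⊆L₀ ∘ there) (inj₂ (B⊆L₀ here) ∷ acc)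
    in  r , ℤP.≤-trans r≤ (reversed-weight≤ (B⊆L₀ here) acc)
    where
      reversed-weight≤ : ∀ {u v z} (vu∈L₀ : (v , u) ∈ L₀) (acc : Walk Residual v z) →
                         weight (inj₂ vu∈L₀ ∷ acc) ℤ.≤ weight acc
      reversed-weight≤ {u} {v} _ acc =
        ℤP.≤-trans (ℤP.+-monoˡ-≤ (weight acc) (ℤP.neg-mono-≤ {0ℤ} {+ c v u} (ℤ.+≤+ ℕ.z≤n)))
                   (ℤP.≤-reflexive (ℤP.+-identityˡ (weight acc)))

  returnWalk : ∀ {u x} → (u , x) ∈ L₀ → Σ (Walk Residual t x) λ r → weight r ℤ.≤ 0ℤ
  returnWalk ux∈L₀ =
    let a , ux∈Sa = ∈L₀⇒EdgeSetOf ux∈L₀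
        B , B⊆Sa  = suffixFrom ux∈Sa
    in  reverseOnto B (λ h → EdgeSetOf⇒∈L₀ (a , B⊆Sa h)) []

  module _ (minimal : ∀ (Q : Fin k → Walk G s t) → IsPathFamily Q → familyCost c S ≤ familyCost c Q) where

    no-negative-cycle : NegativeCycle → ⊥
    no-negative-cycle cycle = ℤP.<-irrefl refl (begin-strict
      + familyCost c S          ≤⟨ ℤ.+≤+ (minimal paths family) ⟩
      + familyCost c paths      ≤⟨ cost≤ ⟩
      listCost c L₁             ≡⟨ listCost-augment C C! ⟩
      listCost c L₀ + weight C  <⟨ ℤP.+-monoʳ-< (listCost c L₀) negative ⟩
      listCost c L₀ + 0ℤ        ≡⟨ ℤP.+-identityʳ _ ⟩
      listCost c L₀             ≡⟨ L₀-cost ⟩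
      + familyCost c S          ∎)
      where
        open ℤP.≤-Reasoning
        open NegativeCycle cycle
        C : Walk Residual v₀ v₀
        C = edge ∷ back
        C! : Unique (tails C)
        C! = ¬Any⇒All¬ _ (path⇒end∉tails back back-path) ∷ path⇒tails-unique back back-path
        L₁ : List Edge
        L₁ = augment C
        L₁-flow : IsFlow s t k L₁
        L₁-flow v = begin-equality
          netFlow L₁ v                      ≡⟨ netFlow-augment C C! v ⟩
          netFlow L₀ v + (δ v v₀ - δ v v₀)  ≡⟨ cong (_+_ (netFlow L₀ v)) (ℤP.+-inverseʳ (δ v v₀)) ⟩
          netFlow L₀ v + 0ℤ                 ≡⟨ ℤP.+-identityʳ _ ⟩
          netFlow L₀ v                      ≡⟨ L₀-flow v ⟩
          + k * (δ v s - δ v t)             ∎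
        L₁-inGraph : InGraph L₁
        L₁-inGraph = Sum.[ L₀-inGraph , forward-inGraph C ] ∘ ∈augment⁻ C
        open Decomposition (decompose s≢t k L₁ (augment-unique C C!) L₁-inGraph L₁-flow)

    closedWalk-nonneg : ∀ {x} (w : Walk Residual x x) → 0ℤ ℤ.≤ weight w
    closedWalk-nonneg w with negativeCycle⊎shorterPath w
    ... | inj₁ cycle                  = ⊥-elim (no-negative-cycle cycle)
    ... | inj₂ (p , p-path , p≤w , _) rewrite closedPath≡[] p p-path = p≤w

    toSink-nonneg : ∀ {q} (w : Walk Residual q t) → 0ℤ ℤ.≤ weight w
    toSink-nonneg []                 = ℤP.≤-refl
    toSink-nonneg (inj₁ _ ∷ w)       = ℤP.+-mono-≤ (ℤ.+≤+ ℕ.z≤n) (toSink-nonneg w)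
    toSink-nonneg w@(inj₂ ux∈L₀ ∷ _) =
      let r , r≤0 = returnWalk ux∈L₀ in begin
        0ℤ                   ≤⟨ closedWalk-nonneg (w ++ʷ r) ⟩
        weight (w ++ʷ r)     ≡⟨ weight-++ w r ⟩
        weight w + weight r  ≤⟨ ℤP.+-monoʳ-≤ (weight w) r≤0 ⟩
        weight w + 0ℤ        ≡⟨ ℤP.+-identityʳ _ ⟩
        weight w             ∎
      where open ℤP.≤-Reasoning

  module _ {H : Graph n} (H⊆G : SpanningSubgraph H G) where

    embed : ∀ {u v} → Ht G H (EdgeSetOf S) t u v → Residual u v
    embed {u} {v} (keep uv∈H uv∉S) = inj₁ (H⊆G u v uv∈H , uv∉S ∘ ∈L₀⇒EdgeSetOf)
    embed (rev vu∈S)               = inj₂ (EdgeSetOf⇒∈L₀ vu∈S)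
    embed (add uv∈G uv∉S _)        = inj₁ (uv∈G , uv∉S ∘ ∈L₀⇒EdgeSetOf)

    embedWalk : ∀ {x y} → Walk (Ht G H (EdgeSetOf S) t) x y → Walk Residual x y
    embedWalk []      = []
    embedWalk (e ∷ w) = embed e ∷ embedWalk w

    htCost≡weight : ∀ {x y} (w : Walk (Ht G H (EdgeSetOf S) t) x y) → htCost c w ≡ weight (embedWalk w)
    htCost≡weight []      = refl
    htCost≡weight (e ∷ w) = cong₂ _+_ (edgeCost≡ e) (htCost≡weight w)
      where
        edgeCost≡ : ∀ {u v} (e : Ht G H (EdgeSetOf S) t u v) → htEdgeCost c e ≡ residualCost (embed e)
        edgeCost≡ (keep _ _)  = refl
        edgeCost≡ (rev _)     = refl
        edgeCost≡ (add _ _ _) = refl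

lemma9 : ∀ {n} (G : Graph n) (c : Fin n → Fin n → ℕ) (s : Fin n) (p : ℕ)
  → AntiSymmetric G → 1 ≤ p → OutConnected G s p
  → (i : ℕ) → 2 ≤ i → i ≤ p
  → (H : Graph n) → SpanningSubgraph H G
  → (t : Fin n) → t ≢ s
  → (S : Fin (i ∸ 1) → Walk G s t) → IsPathFamily S
  → (∀ u v → EdgeSetOf S u v → H u v)
  → (∀ (Q : Fin (i ∸ 1) → Walk G s t) → IsPathFamily Q → familyCost c S ≤ familyCost c Q)
  → (q : Fin n) → Reachable (Ht G H (EdgeSetOf S) t) q t
  → ∀ (w : Walk (Ht G H (EdgeSetOf S) t) q t) → IsPath w
  → (+ 0) ℤ.≤ htCost c w
lemma9 G c _ _ anti _ _ _ _ _ H H⊆G t t≢s S S-family _ minimal _ _ w _ =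
  subst (0ℤ ℤ.≤_) (sym (htCost≡weight H⊆G w)) (toSink-nonneg minimal (embedWalk H⊆G w))
  where open MinCostFamily G c anti (t≢s ∘ sym) S S-family
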